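{- Let $\mathbf{P}$ be the set of prime numbers, let $\mathbf{X}=(\mathbf{N},\tau)$ be the space defined in the context, and let $A\subset\mathbf{P}$ be non-empty. Then $A$ is dense in $\mathbf{X}$ if and only if $\#A=\aleph_0$ (i.e. $A$ is infinite).
   Context: $\mathbf{N}$ denotes the set of positive integers. For $n\in\mathbf{N}$ let $\sigma_n=\{m\in\mathbf{N}:\gcd(n,m)=1\}$. The family $\{\sigma_n:n\in\mathbf{N}\}$ is a base for a topology $\tau$ on $\mathbf{N}$, and $\mathbf{X}=(\mathbf{N},\tau)$. $\aleph_0=\#\mathbf{N}$. -}

module Defs where

open import Level using (0ℓ)
open import Data.Nat using (ℕ; _≥_)
open import Data.Nat.Coprimality using (Coprime)
open import Data.Nat.Primality using (Prime)
open import Data.Product using (Σ; _×_; ∃)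
open import Data.List using (List)
open import Data.List.Membership.Propositional using (_∉_)
open import Relation.Unary using (Pred; _∈_; _⊆_)

-- Points of X are the positive integers; we use ℕ and restrict to m ≥ 1.
Subset : Set₁
Subset = Pred ℕ 0ℓ

Pos : Subset
Pos m = m ≥ 1

σ : ℕ → Subset
σ n m = (m ≥ 1) × Coprime n m

IsOpen : Subset → Set
IsOpen U = (U ⊆ Pos) × (∀ {x} → x ∈ U → Σ ℕ λ n → (n ≥ 1) × (x ∈ σ n) × (σ n ⊆ U))

Dense : Subset → Set₁
Dense A = (U : Subset) → IsOpen U → (∃ λ x → x ∈ U) → ∃ λ y → (y ∈ U) × (y ∈ A)

Primes : Subset
Primes = Prime

Infinite : Subset → Set
Infinite A = (xs : List ℕ) → ∃ λ a → (a ∈ A) × (a ∉ xs)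

-- A set of primes meets the basic open set σ n exactly when it contains a
-- prime not dividing n.  Every prime above n qualifies, so an unbounded set
-- of primes meets every σ n; conversely, a prime in σ (n !) divides no number
-- up to n, so a set meeting all the σ (n !) has primes beyond every bound.
module Submission where

open import Defs
open import Data.Product using (∃; _×_; _,_; proj₁)
open import Relation.Unary using (_⊆_; _∈_)
open import Function.Bundles using (_⇔_; mk⇔)
import Function.Properties.Equivalence as ⇔
open import Data.Nat using (suc; _≤_; _≰_; _<_; _≥_; _!; NonZero; s≤s; z≤n)
open import Data.Nat.Properties using (1≤n!; ≤-trans; ≰⇒>; ≮⇒≥; <⇒≱)
open import Data.Nat.Divisibility using (_∣_; ∣-refl; ∣-trans; m∣m*n; m≤n⇒m!∣n!)
open import Data.Nat.Primality using (Prime; prime⇒nonZero; ¬prime[1])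
open import Data.Nat.Coprimality using (Coprime; 1-coprimeTo; prime⇒coprime)
  renaming (sym to coprime-sym)
open import Data.List using (upTo)
open import Data.List.Extrema.Nat using (max; xs≤max)
import Data.List.Relation.Unary.All as All
open import Data.List.Membership.Propositional.Properties using (∈-upTo⁺)
open import Relation.Binary.PropositionalEquality using (refl)

MeetsBasicOpens : Subset → Set
MeetsBasicOpens A = ∀ n → n ≥ 1 → ∃ λ a → (a ∈ σ n) × (a ∈ A)

Unbounded : Subset → Set
Unbounded A = ∀ n → ∃ λ a → (a ∈ A) × (n < a)

σ-isOpen : ∀ {n} → n ≥ 1 → IsOpen (σ n)
σ-isOpen {n} n≥1 = proj₁ , λ x∈σn → n , n≥1 , x∈σn , λ y∈σn → y∈σn

1∈σ : ∀ n → 1 ∈ σ n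
1∈σ n = s≤s z≤n , coprime-sym (1-coprimeTo n)

dense⇔meetsBasicOpens : ∀ {A} → Dense A ⇔ MeetsBasicOpens A
dense⇔meetsBasicOpens {A} = mk⇔ meets dense
  where
  meets : Dense A → MeetsBasicOpens A
  meets A-dense n n≥1 = A-dense (σ n) (σ-isOpen n≥1) (1 , 1∈σ n)

  dense : MeetsBasicOpens A → Dense A
  dense A-meets U (_ , basic) (_ , x∈U) with basic x∈U
  ... | n , n≥1 , _ , σn⊆U with A-meets n n≥1
  ...   | a , a∈σn , a∈A = a , σn⊆U a∈σn , a∈A

infinite⇔unbounded : ∀ {A} → Infinite A ⇔ Unbounded A
infinite⇔unbounded {A} = mk⇔ unbounded infinite
  where
  unbounded : Infinite A → Unbounded A
  unbounded A-inf n with A-inf (upTo (suc n))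
  ... | a , a∈A , a∉upTo = a , a∈A , ≮⇒≥ (λ a<1+n → a∉upTo (∈-upTo⁺ a<1+n))

  infinite : Unbounded A → Infinite A
  infinite A-unb xs with A-unb (max 0 xs)
  ... | a , a∈A , max<a = a , a∈A , λ a∈xs → <⇒≱ max<a (All.lookup (xs≤max 0 xs) a∈xs)

m≤n⇒m∣n! : ∀ {m n} → .{{NonZero m}} → m ≤ n → m ∣ n !
m≤n⇒m∣n! {suc k} m≤n = ∣-trans (m∣m*n (k !)) (m≤n⇒m!∣n! m≤n)

prime-coprimeTo-n!⇒> : ∀ {n p} → Prime p → Coprime (n !) p → n < p
prime-coprimeTo-n!⇒> {n} {p} p-prime p⊥n! = ≰⇒> p≰n
  where
  instance _ = prime⇒nonZero p-prime
  p≰n : p ≰ n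
  p≰n p≤n with p⊥n! (m≤n⇒m∣n! p≤n , ∣-refl)
  ... | refl = ¬prime[1] p-prime

meetsBasicOpens⇔unbounded : ∀ {A} → A ⊆ Primes → MeetsBasicOpens A ⇔ Unbounded A
meetsBasicOpens⇔unbounded {A} A⊆P = mk⇔ unbounded meets
  where
  unbounded : MeetsBasicOpens A → Unbounded A
  unbounded A-meets n with A-meets (n !) (1≤n! n)
  ... | a , (_ , a⊥n!) , a∈A = a , a∈A , prime-coprimeTo-n!⇒> (A⊆P a∈A) a⊥n!

  meets : Unbounded A → MeetsBasicOpens A
  meets A-unb n@(suc _) _ with A-unb n
  ... | a , a∈A , n<a = a , (≤-trans (s≤s z≤n) n<a , a⊥n) , a∈A
    where
    a⊥n : Coprime n a
    a⊥n = coprime-sym (prime⇒coprime (A⊆P a∈A) n<a)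

mainTheorem5 : (A : Subset) → A ⊆ Primes → (∃ λ a → a ∈ A) →
    (Dense A ⇔ Infinite A)
mainTheorem5 A A⊆P _ =
  ⇔.trans dense⇔meetsBasicOpens
    (⇔.trans (meetsBasicOpens⇔unbounded A⊆P) (⇔.sym infinite⇔unbounded))
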